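{- Let $n\ge0$. Every sequence of $2^n$ non-negative integers whose sum equals $2^n$ can be reordered into a block-sequence.
   Context: A block-sequence is a sequence $[v_0,v_1,\dots,v_{2^n-1}]$ of $2^n$ non-negative integers such that for every $i=0,\dots,n$ and every $0\le j<2^{n-i}$, $\sum_{j2^i\le l<(j+1)2^i} v_l\equiv 0 \pmod{2^i}$. -}

module Defs where

open import Data.Nat using (ℕ; _+_; _*_; _∸_; _^_; _≤_; _<_)
open import Data.Nat.Divisibility using (_∣_)
open import Data.Nat.ListAction using (sum)
open import Data.List using (List; length; take; drop)
open import Data.Product using (_×_)
open import Relation.Binary.PropositionalEquality using (_≡_)

block : (i j : ℕ) → List ℕ → List ℕ
block i j v = take (2 ^ i) (drop (j * 2 ^ i) v)

IsBlockSequence : ℕ → List ℕ → Set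
IsBlockSequence n v =
  length v ≡ 2 ^ n ×
  ((i j : ℕ) → i ≤ n → j < 2 ^ (n ∸ i) → 2 ^ i ∣ sum (block i j v))

-- Strengthen the claim to lists of length 2^n whose sum is divisible by 2^n,
-- and induct on n. A list of even length and even sum splits into pairs with
-- even sums: pair the head with another entry of the same parity, which
-- exists because otherwise the odd number of remaining entries would make
-- the total sum odd. The half pair sums form a list of length 2^(n-1) with
-- sum divisible by 2^(n-1); rearrange it into a block-sequence, permute the
-- pairs along and flatten them. A block of size 2^(i+1) of the result has
-- twice the sum of a block of size 2^i of the halved list.

module Submission where

open import Defs
open import Data.Nat using (ℕ; _^_)
open import Data.List using (List; length)
open import Data.Nat.ListAction using (sum)
open import Data.List.Relation.Binary.Permutation.Propositional using (_↭_)
open import Data.Product using (Σ; _×_)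
open import Relation.Binary.PropositionalEquality using (_≡_)

open import Data.Nat using (zero; suc; pred; _+_; _*_; _∸_; _≤_; _<_; s≤s⁻¹; ⌊_/2⌋; parity)
open import Data.Nat.Properties using (+-assoc; *-suc; *-distribˡ-+; *-commutativeSemigroup)
open import Data.Nat.Divisibility using (_∣_; divides; 1∣_; ∣-reflexive; ∣-trans; m∣m*n; *-monoʳ-∣; *-cancelˡ-∣)
open import Data.Nat.ListAction.Properties using (sum-↭)
open import Data.Parity.Base as ℙ using (0ℙ; 1ℙ; _⁻¹)
open import Data.Parity.Properties as ℙ using (_≟_; +-homo-+; *-homo-*; p+p≡0ℙ; p+p⁻¹≡1ℙ)
open import Algebra.Properties.CommutativeSemigroup *-commutativeSemigroup using (x∙yz≈y∙xz)
open import Data.List using ([]; _∷_; _++_; map; take; drop)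
open import Data.List.Properties using (length-map; take-map; drop-map)
open import Data.List.Relation.Unary.All as All using (All; []; _∷_)
open import Data.List.Relation.Unary.All.Properties using (¬Any⇒All¬)
open import Data.List.Relation.Unary.Any using (any?)
open import Data.List.Membership.Propositional using (find)
open import Data.List.Membership.Propositional.Properties using (∈-∃++)
import Data.List.Relation.Binary.Permutation.Propositional as Perm
open Perm using (↭-refl; ↭-trans; prep)
open import Data.List.Relation.Binary.Permutation.Propositional.Properties
  using (↭-length; ↭-map-inv; shift; shifts; ++⁺ˡ)
open import Data.Product using (∃-syntax; _,_)
open import Data.Empty using (⊥-elim)
open import Relation.Nullary using (yes; no)
open import Relation.Binary.PropositionalEquality using (_≢_; refl; sym; trans; cong; cong₂; subst; module ≡-Reasoning)

open ≡-Reasoning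

parity≡0ℙ⇒2*⌊n/2⌋≡n : ∀ n → parity n ≡ 0ℙ → 2 * ⌊ n /2⌋ ≡ n
parity≡0ℙ⇒2*⌊n/2⌋≡n zero          _  = refl
parity≡0ℙ⇒2*⌊n/2⌋≡n (suc (suc n)) eq =
  trans (*-suc 2 ⌊ n /2⌋) (cong (2 +_) (parity≡0ℙ⇒2*⌊n/2⌋≡n n eq))

2∣⇒parity≡0ℙ : ∀ {n} → 2 ∣ n → parity n ≡ 0ℙ
2∣⇒parity≡0ℙ (divides q refl) = trans (*-homo-* q 2) (ℙ.*-zeroʳ (parity q))

parity[1+2*n]≡1ℙ : ∀ n → parity (suc (2 * n)) ≡ 1ℙ
parity[1+2*n]≡1ℙ n = trans (+-homo-+ 1 (2 * n)) (cong (1ℙ ℙ.+_) (*-homo-* 2 n))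

parity[m+n]≡0ℙ⇒parity[m+[n+o]]≡parity[o] : ∀ m n o → parity (m + n) ≡ 0ℙ →
                                          parity (m + (n + o)) ≡ parity o
parity[m+n]≡0ℙ⇒parity[m+[n+o]]≡parity[o] m n o eq =
  trans (cong parity (sym (+-assoc m n o))) (trans (+-homo-+ (m + n) o) (cong (ℙ._+ parity o) eq))

parity≡⇒parity[m+n]≡0ℙ : ∀ {m n} → parity m ≡ parity n → parity (m + n) ≡ 0ℙ
parity≡⇒parity[m+n]≡0ℙ {m} {n} eq =
  trans (+-homo-+ m n) (trans (cong (ℙ._+ parity n) eq) (p+p≡0ℙ (parity n)))

≢⇒≡⁻¹ : ∀ {p q} → p ≢ q → p ≡ q ⁻¹
≢⇒≡⁻¹ {0ℙ} {0ℙ} p≢q = ⊥-elim (p≢q refl)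
≢⇒≡⁻¹ {0ℙ} {1ℙ} _   = refl
≢⇒≡⁻¹ {1ℙ} {0ℙ} _   = refl
≢⇒≡⁻¹ {1ℙ} {1ℙ} p≢q = ⊥-elim (p≢q refl)

parity-sum-All≡ : ∀ {p ys} → All (λ y → parity y ≡ p) ys →
                  parity (sum ys) ≡ parity (length ys) ℙ.* p
parity-sum-All≡ []                        = refl
parity-sum-All≡ {p} {y ∷ ys} (py ∷ pys) = begin
  parity (y + sum ys)                  ≡⟨ +-homo-+ y (sum ys) ⟩
  parity y ℙ.+ parity (sum ys)         ≡⟨ cong₂ ℙ._+_ py (parity-sum-All≡ pys) ⟩
  p ℙ.+ (parity (length ys) ℙ.* p)     ≡⟨ ℙ.*-distribʳ-+ p 1ℙ (parity (length ys)) ⟨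
  (1ℙ ℙ.+ parity (length ys)) ℙ.* p    ≡⟨ cong (ℙ._* p) (+-homo-+ 1 (length ys)) ⟨
  parity (suc (length ys)) ℙ.* p       ∎

∃-sameParity : ∀ x xs → parity (length xs) ≡ 1ℙ → parity (x + sum xs) ≡ 0ℙ →
               ∃[ y ] ∃[ ys ] parity y ≡ parity x × xs ↭ y ∷ ys
∃-sameParity x xs odd Σ-even with any? (λ y → parity y ≟ parity x) xs
... | yes some =
  let y , y∈xs , py≡px = find some
      h , t , xs≡h++y∷t = ∈-∃++ y∈xs
  in y , h ++ t , py≡px , subst (_↭ y ∷ h ++ t) (sym xs≡h++y∷t) (shift y h t)
... | no  none = ⊥-elim (1ℙ≢0ℙ (begin
  1ℙ                                   ≡⟨ p+p⁻¹≡1ℙ (parity x) ⟨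
  parity x ℙ.+ parity x ⁻¹             ≡⟨ cong (parity x ℙ.+_) parity[Σxs]≡parity[x]⁻¹ ⟨
  parity x ℙ.+ parity (sum xs)         ≡⟨ +-homo-+ x (sum xs) ⟨
  parity (x + sum xs)                  ≡⟨ Σ-even ⟩
  0ℙ                                   ∎))
  where
  1ℙ≢0ℙ : 1ℙ ≢ 0ℙ
  1ℙ≢0ℙ ()
  parity[Σxs]≡parity[x]⁻¹ : parity (sum xs) ≡ parity x ⁻¹
  parity[Σxs]≡parity[x]⁻¹ =
    trans (parity-sum-All≡ (All.map ≢⇒≡⁻¹ (¬Any⇒All¬ xs none)))
          (cong (ℙ._* parity x ⁻¹) odd)

record EvenPair : Set where
  constructor evenPair
  field
    fst snd  : ℕ
    sum-even : parity (fst + snd) ≡ 0ℙ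

open EvenPair using (fst; snd)

half : EvenPair → ℕ
half p = ⌊ fst p + snd p /2⌋

unpair : List EvenPair → List ℕ
unpair []       = []
unpair (p ∷ ps) = fst p ∷ snd p ∷ unpair ps

unpair-↭ : ∀ {ps qs} → ps ↭ qs → unpair ps ↭ unpair qs
unpair-↭ Perm.refl         = ↭-refl
unpair-↭ (Perm.prep p σ)   = prep (fst p) (prep (snd p) (unpair-↭ σ))
unpair-↭ (Perm.swap p q σ) =
  ↭-trans (shifts (fst p ∷ snd p ∷ []) (fst q ∷ snd q ∷ []))
          (++⁺ˡ (fst q ∷ snd q ∷ fst p ∷ snd p ∷ []) (unpair-↭ σ))
unpair-↭ (Perm.trans σ τ)  = ↭-trans (unpair-↭ σ) (unpair-↭ τ)

pairUp : ∀ m xs → length xs ≡ 2 * m → parity (sum xs) ≡ 0ℙ →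
         ∃[ ps ] length ps ≡ m × xs ↭ unpair ps
pairUp zero    []       _   _      = [] , refl , ↭-refl
pairUp (suc m) (x ∷ xs) len Σ-even =
  let y , ys , py≡px , σ = ∃-sameParity x xs (trans (cong parity length-xs) (parity[1+2*n]≡1ℙ m)) Σ-even
      x+y-even = parity≡⇒parity[m+n]≡0ℙ {x} {y} (sym py≡px)
      ys-even = trans (sym (parity[m+n]≡0ℙ⇒parity[m+[n+o]]≡parity[o] x y (sum ys) x+y-even))
                      (trans (cong (λ s → parity (x + s)) (sym (sum-↭ σ))) Σ-even)
      ps , lps , τ = pairUp m ys (cong pred (trans (sym (↭-length σ)) length-xs)) ys-even
  in evenPair x y x+y-even ∷ ps , cong suc lps , prep x (↭-trans σ (prep y τ))
  where
  length-xs : length xs ≡ suc (2 * m)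
  length-xs = cong pred (trans len (*-suc 2 m))

length-unpair : ∀ ps → length (unpair ps) ≡ 2 * length ps
length-unpair []       = refl
length-unpair (p ∷ ps) =
  trans (cong (2 +_) (length-unpair ps)) (sym (*-suc 2 (length ps)))

sum-unpair : ∀ ps → sum (unpair ps) ≡ 2 * sum (map half ps)
sum-unpair []       = refl
sum-unpair (p@(evenPair a b a+b-even) ∷ ps) = begin
  a + (b + sum (unpair ps))                 ≡⟨ +-assoc a b _ ⟨
  a + b + sum (unpair ps)
    ≡⟨ cong₂ _+_ (sym (parity≡0ℙ⇒2*⌊n/2⌋≡n (a + b) a+b-even)) (sum-unpair ps) ⟩
  2 * half p + 2 * sum (map half ps)        ≡⟨ *-distribˡ-+ 2 (half p) _ ⟨
  2 * (half p + sum (map half ps))          ∎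

take-unpair : ∀ k ps → take (2 * k) (unpair ps) ≡ unpair (take k ps)
take-unpair zero    ps       = refl
take-unpair (suc k) []       = refl
take-unpair (suc k) (p ∷ ps) =
  trans (cong (λ n → take n (unpair (p ∷ ps))) (*-suc 2 k))
        (cong (λ zs → fst p ∷ snd p ∷ zs) (take-unpair k ps))

drop-unpair : ∀ k ps → drop (2 * k) (unpair ps) ≡ unpair (drop k ps)
drop-unpair zero    ps       = refl
drop-unpair (suc k) []       = refl
drop-unpair (suc k) (p ∷ ps) =
  trans (cong (λ n → drop n (unpair (p ∷ ps))) (*-suc 2 k)) (drop-unpair k ps)

sum-block-unpair : ∀ i j ps →
                   sum (block (suc i) j (unpair ps)) ≡ 2 * sum (block i j (map half ps))
sum-block-unpair i j ps = begin
  sum (take (2 * M) (drop (j * (2 * M)) (unpair ps)))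
    ≡⟨ cong (λ k → sum (take (2 * M) (drop k (unpair ps)))) (x∙yz≈y∙xz j 2 M) ⟩
  sum (take (2 * M) (drop (2 * (j * M)) (unpair ps)))
    ≡⟨ cong (λ zs → sum (take (2 * M) zs)) (drop-unpair (j * M) ps) ⟩
  sum (take (2 * M) (unpair (drop (j * M) ps)))
    ≡⟨ cong sum (take-unpair M (drop (j * M) ps)) ⟩
  sum (unpair (take M (drop (j * M) ps)))
    ≡⟨ sum-unpair (take M (drop (j * M) ps)) ⟩
  2 * sum (map half (take M (drop (j * M) ps)))
    ≡⟨ cong (λ zs → 2 * sum zs) block≡ ⟨
  2 * sum (block i j (map half ps))
    ∎
  where
  M = 2 ^ i
  block≡ : block i j (map half ps) ≡ map half (take M (drop (j * M) ps))
  block≡ = trans (cong (take M) (drop-map (j * M) ps)) (take-map M (drop (j * M) ps))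

unpair-isBlockSequence : ∀ n ps → IsBlockSequence n (map half ps) →
                         IsBlockSequence (suc n) (unpair ps)
unpair-isBlockSequence n ps (len , blocks) = length-unpair≡ , blocks′
  where
  length-unpair≡ : length (unpair ps) ≡ 2 ^ suc n
  length-unpair≡ = trans (length-unpair ps) (cong (2 *_) (trans (sym (length-map half ps)) len))
  blocks′ : ∀ i j → i ≤ suc n → j < 2 ^ (suc n ∸ i) → 2 ^ i ∣ sum (block i j (unpair ps))
  blocks′ zero    j _   _  = 1∣ _
  blocks′ (suc i) j i≤n j< =
    subst (2 ^ suc i ∣_) (sym (sum-block-unpair i j ps)) (*-monoʳ-∣ 2 (blocks i j (s≤s⁻¹ i≤n) j<))

↭-isBlockSequence : ∀ n v → length v ≡ 2 ^ n → 2 ^ n ∣ sum v →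
                    ∃[ w ] v ↭ w × IsBlockSequence n w
↭-isBlockSequence zero    v len _ = v , ↭-refl , len , λ { zero _ _ _ → 1∣ _ }
↭-isBlockSequence (suc n) v len 2ⁿ⁺¹∣Σv =
  let ps , lps , σ = pairUp (2 ^ n) v len (2∣⇒parity≡0ℙ (∣-trans (m∣m*n (2 ^ n)) 2ⁿ⁺¹∣Σv))
      Σv≡2*Σhalves = trans (sum-↭ σ) (sum-unpair ps)
      w , τ , isBlock = ↭-isBlockSequence n (map half ps) (trans (length-map half ps) lps)
                          (*-cancelˡ-∣ 2 (subst (2 ^ suc n ∣_) Σv≡2*Σhalves 2ⁿ⁺¹∣Σv))
      ps′ , w≡halves′ , ps↭ps′ = ↭-map-inv half τ
  in unpair ps′ , ↭-trans σ (unpair-↭ ps↭ps′) ,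
     unpair-isBlockSequence n ps′ (subst (IsBlockSequence n) w≡halves′ isBlock)

lemma17 : (n : ℕ) (v : List ℕ) → length v ≡ 2 ^ n → sum v ≡ 2 ^ n →
    Σ (List ℕ) (λ w → (v ↭ w) × IsBlockSequence n w)
lemma17 n v len Σv≡2ⁿ = ↭-isBlockSequence n v len (∣-reflexive (sym Σv≡2ⁿ))
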